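{- Let $\mathcal{P}_2$ be the class of all finite graphs of pathwidth at most $2$. Then the indeque ratio of $\mathcal{P}_2$ equals $1/2$, i.e. \[ \lim_{n\to\infty}\frac{\min\{\iota(G): G\in\mathcal{P}_2,\ |V(G)|=n\}}{n}=\frac12 . \]
   Context: For a finite simple graph $G$, a set $S\subseteq V(G)$ is an indeque set if the induced subgraph $G[S]$ is a disjoint union of cliques with no edges between distinct cliques. The indeque number $\iota(G)$ is the maximum size of an indeque set of $G$. For a class $\mathcal{G}$ of graphs, let $\iota(\mathcal{G},n)=\min\{\iota(G):G\in\mathcal{G},\ |V(G)|=n\}$, and the indeque ratio of $\mathcal{G}$ is $\lim_{n\to\infty}\iota(\mathcal{G},n)/n$ (this limit exists for classes closed under disjoint union). -}

module Defs where

open import Data.Nat using (ℕ; _≤_; _<_)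
open import Data.Bool using (Bool; true; false)
open import Data.Fin using (Fin)
open import Data.Fin.Subset using (Subset; _∈_; ∣_∣)
open import Data.Product using (Σ; _×_; _,_)
open import Data.Sum using (_⊎_)
open import Relation.Binary.PropositionalEquality using (_≡_; _≢_)
open import Relation.Nullary using (¬_)

record Graph (n : ℕ) : Set where
  field
    adj     : Fin n → Fin n → Bool
    sym     : ∀ u v → adj u v ≡ adj v u
    irrefl  : ∀ v → adj v v ≡ false

open Graph public

Adj : ∀ {n} → Graph n → Fin n → Fin n → Set
Adj G u v = adj G u v ≡ true

-- S is an indeque set: G[S] is a disjoint union of cliques with no edges
-- between distinct cliques, i.e. the relation "u = v or uv ∈ E" restricted
-- to S is an equivalence relation (its classes are the cliques).
IsIndeque : ∀ {n} → Graph n → Subset n → Set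
IsIndeque {n} G S =
  ∀ (u v w : Fin n) → u ∈ S → v ∈ S → w ∈ S →
  (u ≡ v ⊎ Adj G u v) → (v ≡ w ⊎ Adj G v w) → (u ≡ w ⊎ Adj G u w)

IsIndequeNumber : ∀ {n} → Graph n → ℕ → Set
IsIndequeNumber {n} G k =
  (Σ (Subset n) λ S → IsIndeque G S × ∣ S ∣ ≡ k) ×
  (∀ (S : Subset n) → IsIndeque G S → ∣ S ∣ ≤ k)

record PathDecomposition {n : ℕ} (G : Graph n) (r : ℕ) : Set where
  field
    bag        : Fin r → Subset n
    covers-v   : ∀ (v : Fin n) → Σ (Fin r) λ i → v ∈ bag i
    covers-e   : ∀ (u v : Fin n) → Adj G u v →
                 Σ (Fin r) λ i → (u ∈ bag i) × (v ∈ bag i)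
    interval   : ∀ (v : Fin n) (i j k : Fin r) →
                 Data.Fin._≤_ i j → Data.Fin._≤_ j k →
                 v ∈ bag i → v ∈ bag k → v ∈ bag j

open PathDecomposition public

PathwidthAtMost : ∀ {n} → ℕ → Graph n → Set
PathwidthAtMost w G =
  Σ ℕ λ r → Σ (PathDecomposition G r) λ D →
    ∀ (i : Fin r) → ∣ bag D i ∣ ≤ Data.Nat._+_ w 1

IsMinIndequeP2 : ℕ → ℕ → Set
IsMinIndequeP2 n m =
  (Σ (Graph n) λ G → PathwidthAtMost 2 G × IsIndequeNumber G m) ×
  (∀ (G : Graph n) → PathwidthAtMost 2 G → ∀ k → IsIndequeNumber G k → m ≤ k)

-- Fix a path decomposition of width 2 and a vertex set U.  Let x be the vertex of U
-- whose last bag B comes first, and y the vertex of U - x whose last bag B′ comes first.  The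
-- U-neighbours of x lie in B and are still present at B′, hence lie in B′, and the (U - x)-neighbours
-- of y lie in B′.  So the indeque set {x, y} has all its U-neighbours in {x} ∪ (B′ ∩ U), a set of at
-- most four vertices; removing it and recursing gives an indeque set of at least half of U.
--
-- Upper bound.  Disjoint unions of 4-cycles plus at most three isolated vertices have pathwidth 2,
-- and an indeque set contains at most two vertices of each 4-cycle, so 2ι ≤ n + 3.
--
-- The exact minimum ι(𝒫₂, n) is obtained by exhaustive search: graphs on n vertices and vertex sets
-- are finitely many, and so are the relevant path decompositions, since a decomposition with more
-- than n + 1 bags has a bag contained in its successor, which can be deleted.

module Submission where

open import Defs hiding (sym)

open import Level using (0ℓ)
open import Data.Bool using (Bool; true; false; _xor_)
import Data.Bool as Bool
open import Data.Nat using (ℕ; NonZero; zero; suc; _+_; _*_; _∸_; _≤_; _≤?_; z≤n; s≤s)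
import Data.Nat as ℕ
open import Data.Nat.Properties
  using (≤-reflexive; ≤-trans; ≤-<-trans; <-≤-trans; ≤-pred; n≤1+n; m≤m+n; <⇒≤; ≤⇒≯; ≮⇒≥; <⇒≱;
         ≰⇒>; ≤∧≢⇒<; +-suc; +-identityʳ; +-mono-≤; +-monoʳ-≤; +-cancelˡ-≤; *-comm; *-monoˡ-≤; m≤n*m;
         m<m*n; ∸-monoˡ-≤; m+n∸m≡n; +-commutativeSemigroup; module ≤-Reasoning)
open import Algebra.Properties.CommutativeSemigroup +-commutativeSemigroup using (interchange)
open import Data.Fin using (Fin; zero; suc; toℕ; _≟_)
import Data.Fin as Fin
open import Data.Fin.Properties using (any?; all?)
open import Data.Vec using (Vec; []; _∷_; here; there; lookup)
open import Data.Product using (Σ; ∃; ∃-syntax; _×_; _,_; proj₁; proj₂)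
open import Data.Sum using (_⊎_; inj₁; inj₂)
open import Function using (_∘_)
open import Relation.Binary.PropositionalEquality
  using (_≡_; _≢_; refl; sym; trans; cong; cong₂; subst; subst₂; module ≡-Reasoning)
open import Relation.Nullary using (¬_; Dec; yes; no; contradiction)
open import Relation.Nullary.Decidable
  using (_×-dec_; _→-dec_; _⊎-dec_; ¬?; decidable-stable; map′; from-yes)
open import Relation.Unary using (Pred; Decidable)

module Subsets where

  open import Data.Fin using (_↑ˡ_; _↑ʳ_)
  open import Data.Fin.Subset
  open import Data.Fin.Subset.Properties
  open import Data.Vec using (_++_)

  private variable
    m n k : ℕ

  ∣p∪q∣≤∣p∣+∣q∣ : (p q : Subset n) → ∣ p ∪ q ∣ ≤ ∣ p ∣ + ∣ q ∣
  ∣p∪q∣≤∣p∣+∣q∣ []            []           = z≤n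
  ∣p∪q∣≤∣p∣+∣q∣ (inside  ∷ p) (x ∷ q)      =
    s≤s (≤-trans (∣p∪q∣≤∣p∣+∣q∣ p q) (+-monoʳ-≤ ∣ p ∣ (∣p∣≤∣x∷p∣ x q)))
  ∣p∪q∣≤∣p∣+∣q∣ (outside ∷ p) (inside  ∷ q) rewrite +-suc ∣ p ∣ ∣ q ∣ = s≤s (∣p∪q∣≤∣p∣+∣q∣ p q)
  ∣p∪q∣≤∣p∣+∣q∣ (outside ∷ p) (outside ∷ q) = ∣p∪q∣≤∣p∣+∣q∣ p q

  ∣p∪q∣≡∣p∣+∣q∣ : (p q : Subset n) → (∀ {x} → x ∈ p → x ∉ q) → ∣ p ∪ q ∣ ≡ ∣ p ∣ + ∣ q ∣
  ∣p∪q∣≡∣p∣+∣q∣ []            []            _        = refl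
  ∣p∪q∣≡∣p∣+∣q∣ (inside  ∷ p) (inside  ∷ q) disjoint = contradiction here (disjoint here)
  ∣p∪q∣≡∣p∣+∣q∣ (inside  ∷ p) (outside ∷ q) disjoint =
    cong suc (∣p∪q∣≡∣p∣+∣q∣ p q λ x∈p x∈q → disjoint (there x∈p) (there x∈q))
  ∣p∪q∣≡∣p∣+∣q∣ (outside ∷ p) (inside  ∷ q) disjoint rewrite +-suc ∣ p ∣ ∣ q ∣ =
    cong suc (∣p∪q∣≡∣p∣+∣q∣ p q λ x∈p x∈q → disjoint (there x∈p) (there x∈q))
  ∣p∪q∣≡∣p∣+∣q∣ (outside ∷ p) (outside ∷ q) disjoint =
    ∣p∪q∣≡∣p∣+∣q∣ p q λ x∈p x∈q → disjoint (there x∈p) (there x∈q)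

  ∣p∣≤∣q∣+∣p─q∣ : (p q : Subset n) → ∣ p ∣ ≤ ∣ q ∣ + ∣ p ─ q ∣
  ∣p∣≤∣q∣+∣p─q∣ p q = ≤-trans (p⊆q⇒∣p∣≤∣q∣ p⊆q∪p─q) (∣p∪q∣≤∣p∣+∣q∣ q (p ─ q))
    where
    p⊆q∪p─q : p ⊆ q ∪ (p ─ q)
    p⊆q∪p─q {x} x∈p with x ∈? q
    ... | yes x∈q = x∈p∪q⁺ (inj₁ x∈q)
    ... | no  x∉q = x∈p∪q⁺ (inj₂ (x∈p∧x∉q⇒x∈p─q x∈p x∉q))

  x∈p─q⇒x∉q : ∀ {p q : Subset n} {x} → x ∈ p ─ q → x ∉ q
  x∈p─q⇒x∉q {p = inside ∷ p} {outside ∷ q} here       ()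
  x∈p─q⇒x∉q {p = _ ∷ p}      {_ ∷ q}       (there x∈) (there x∈q) = x∈p─q⇒x∉q x∈ x∈q

  p⊈q⇒∃x∈p∧x∉q : ∀ {p q : Subset n} → ¬ p ⊆ q → ∃[ x ] x ∈ p × x ∉ q
  p⊈q⇒∃x∈p∧x∉q {p = p} {q} p⊈q with any? (λ x → (x ∈? p) ×-dec ¬? (x ∈? q))
  ... | yes found = found
  ... | no  none  =
    contradiction (λ {x} x∈p → decidable-stable (x ∈? q) λ x∉q → none (x , x∈p , x∉q)) p⊈q

  x∈⁅x⁆∪⁅y⁆⁻ : ∀ {x y z : Fin n} → z ∈ ⁅ x ⁆ ∪ ⁅ y ⁆ → z ≡ x ⊎ z ≡ y
  x∈⁅x⁆∪⁅y⁆⁻ {x = x} {y} z∈ with x∈p∪q⁻ ⁅ x ⁆ ⁅ y ⁆ z∈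
  ... | inj₁ z∈x = inj₁ (x∈⁅y⁆⇒x≡y x z∈x)
  ... | inj₂ z∈y = inj₂ (x∈⁅y⁆⇒x≡y y z∈y)

  ∣⁅x⁆∪⁅y⁆∣≡2 : ∀ {x y : Fin n} → x ≢ y → ∣ ⁅ x ⁆ ∪ ⁅ y ⁆ ∣ ≡ 2
  ∣⁅x⁆∪⁅y⁆∣≡2 {x = x} {y} x≢y = begin
    ∣ ⁅ x ⁆ ∪ ⁅ y ⁆ ∣      ≡⟨ ∣p∪q∣≡∣p∣+∣q∣ ⁅ x ⁆ ⁅ y ⁆ disjoint ⟩
    ∣ ⁅ x ⁆ ∣ + ∣ ⁅ y ⁆ ∣  ≡⟨ cong₂ _+_ (∣⁅x⁆∣≡1 x) (∣⁅x⁆∣≡1 y) ⟩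
    2                      ∎
    where
    open ≡-Reasoning
    disjoint : ∀ {z} → z ∈ ⁅ x ⁆ → z ∉ ⁅ y ⁆
    disjoint z∈x z∈y = x≢y (trans (sym (x∈⁅y⁆⇒x≡y x z∈x)) (x∈⁅y⁆⇒x≡y y z∈y))

  Empty[p-x]⇒p⊆⁅x⁆ : ∀ {p : Subset n} {x} → Empty (p - x) → p ⊆ ⁅ x ⁆
  Empty[p-x]⇒p⊆⁅x⁆ {x = x} empty {y} y∈p with y ≟ x
  ... | yes refl = x∈⁅x⁆ x
  ... | no  y≢x  = contradiction (y , x∈p∧x≢y⇒x∈p-y y∈p y≢x) empty

  ∈-++⁺ˡ : ∀ {A : Subset m} {B : Subset k} {i} → i ∈ A → i ↑ˡ k ∈ A ++ B
  ∈-++⁺ˡ here       = here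
  ∈-++⁺ˡ (there i∈) = there (∈-++⁺ˡ i∈)

  ∈-++⁻ˡ : ∀ {A : Subset m} {B : Subset k} {i} → i ↑ˡ k ∈ A ++ B → i ∈ A
  ∈-++⁻ˡ {A = _ ∷ _} {i = zero}  here       = here
  ∈-++⁻ˡ {A = _ ∷ _} {i = suc i} (there i∈) = there (∈-++⁻ˡ i∈)

  ∈-++⁺ʳ : ∀ (A : Subset m) {B : Subset k} {j} → j ∈ B → m ↑ʳ j ∈ A ++ B
  ∈-++⁺ʳ []      j∈ = j∈
  ∈-++⁺ʳ (_ ∷ A) j∈ = there (∈-++⁺ʳ A j∈)

  ∈-++⁻ʳ : ∀ (A : Subset m) {B : Subset k} {j} → m ↑ʳ j ∈ A ++ B → j ∈ B
  ∈-++⁻ʳ []      j∈         = j∈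
  ∈-++⁻ʳ (_ ∷ A) (there j∈) = ∈-++⁻ʳ A j∈

  ∣A++B∣≡∣A∣+∣B∣ : ∀ (A : Subset m) (B : Subset k) → ∣ A ++ B ∣ ≡ ∣ A ∣ + ∣ B ∣
  ∣A++B∣≡∣A∣+∣B∣ []            B = refl
  ∣A++B∣≡∣A∣+∣B∣ (inside  ∷ A) B = cong suc (∣A++B∣≡∣A∣+∣B∣ A B)
  ∣A++B∣≡∣A∣+∣B∣ (outside ∷ A) B = ∣A++B∣≡∣A∣+∣B∣ A B

module Basics where

  open import Data.Sum using (map)
  open import Data.Fin.Subset
  open import Data.Fin.Subset.Properties

  private variable
    m n r : ℕ

  Adj⁼ : Graph n → Fin n → Fin n → Set
  Adj⁼ G u v = u ≡ v ⊎ Adj G u v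

  IndequeAtMost : Graph n → ℕ → Set
  IndequeAtMost G k = ∀ S → IsIndeque G S → ∣ S ∣ ≤ k

  Narrow : {G : Graph n} → ℕ → PathDecomposition G r → Set
  Narrow w D = ∀ i → ∣ bag D i ∣ ≤ w + 1

  module _ {G : Graph n} where

    Adj-sym : ∀ {u v} → Adj G u v → Adj G v u
    Adj-sym {u} {v} uv = trans (Graph.sym G v u) uv

    Adj-irrefl : ∀ {u v} → Adj G u v → u ≢ v
    Adj-irrefl {u} uv refl with trans (sym uv) (irrefl G u)
    ... | ()

    Adj⁼-sym : ∀ {u v} → Adj⁼ G u v → Adj⁼ G v u
    Adj⁼-sym (inj₁ u≡v) = inj₁ (sym u≡v)
    Adj⁼-sym (inj₂ uv)  = inj₂ (Adj-sym uv)

    ⊥-indeque : IsIndeque G ⊥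
    ⊥-indeque _ _ _ u∈⊥ = contradiction u∈⊥ ∉⊥

    indeque-⊆pair : ∀ {S x y} → (∀ {z} → z ∈ S → z ≡ x ⊎ z ≡ y) → IsIndeque G S
    indeque-⊆pair S⊆xy u v w u∈S v∈S w∈S uv vw with S⊆xy u∈S | S⊆xy v∈S | S⊆xy w∈S
    ... | inj₁ refl | inj₁ refl | _         = vw
    ... | inj₂ refl | inj₂ refl | _         = vw
    ... | _         | inj₁ refl | inj₁ refl = uv
    ... | _         | inj₂ refl | inj₂ refl = uv
    ... | inj₁ refl | inj₂ refl | inj₁ refl = inj₁ refl
    ... | inj₂ refl | inj₁ refl | inj₂ refl = inj₁ refl

    ∪-indeque : ∀ {A B} → IsIndeque G A → IsIndeque G B →
                (∀ {a b} → a ∈ A → b ∈ B → ¬ Adj⁼ G a b) → IsIndeque G (A ∪ B)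
    ∪-indeque {A} {B} indA indB apart u v w u∈ v∈ w∈ uv vw
      with x∈p∪q⁻ A B u∈ | x∈p∪q⁻ A B v∈ | x∈p∪q⁻ A B w∈
    ... | inj₁ u∈A | inj₁ v∈A | inj₁ w∈A = indA u v w u∈A v∈A w∈A uv vw
    ... | inj₂ u∈B | inj₂ v∈B | inj₂ w∈B = indB u v w u∈B v∈B w∈B uv vw
    ... | inj₁ u∈A | inj₂ v∈B | _        = contradiction uv (apart u∈A v∈B)
    ... | inj₂ u∈B | inj₁ v∈A | _        = contradiction (Adj⁼-sym uv) (apart v∈A u∈B)
    ... | _        | inj₁ v∈A | inj₂ w∈B = contradiction vw (apart v∈A w∈B)
    ... | _        | inj₂ v∈B | inj₁ w∈A = contradiction (Adj⁼-sym vw) (apart w∈A v∈B)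

  indeque-preimage : ∀ {G : Graph m} {H : Graph n} (f : Fin m → Fin n) →
    (∀ {i j} → f i ≡ f j → i ≡ j) → (∀ i j → adj H (f i) (f j) ≡ adj G i j) →
    ∀ {S A} → IsIndeque H S → (∀ {i} → i ∈ A → f i ∈ S) → IsIndeque G A
  indeque-preimage {G = G} {H} f injective embeds S-indeque A↦S u v w u∈ v∈ w∈ uv vw =
    reflect (S-indeque (f u) (f v) (f w) (A↦S u∈) (A↦S v∈) (A↦S w∈) (preserve uv) (preserve vw))
    where
    preserve : ∀ {i j} → Adj⁼ G i j → Adj⁼ H (f i) (f j)
    preserve {i} {j} = map (cong f) (trans (embeds i j))
    reflect : ∀ {i j} → Adj⁼ H (f i) (f j) → Adj⁼ G i j
    reflect {i} {j} = map injective (trans (sym (embeds i j)))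

module LowerBound where

  open Subsets
  open Basics
  open import Data.Nat using (_<_)
  open import Data.Nat.Induction using (<-wellFounded)
  open import Data.Fin.Properties using (toℕ<n)
  open import Data.Fin.Subset
  open import Data.Fin.Subset.Properties
  open import Induction.WellFounded using (Acc; acc)

  private variable
    n r : ℕ

  record Peeling (G : Graph n) (U : Subset n) : Set where
    field
      picked removed  : Subset n
      picked⊆removed  : picked ⊆ removed
      removed⊆U       : removed ⊆ U
      picked-indeque  : IsIndeque G picked
      picked-nonempty : Nonempty picked
      removed-small   : ∣ removed ∣ ≤ ∣ picked ∣ + ∣ picked ∣
      removed-closed  : ∀ {u w} → u ∈ picked → w ∈ U → Adj G u w → w ∈ removed

    removes-some : Nonempty (U ∩ removed)
    removes-some =
      let (z , z∈picked) = picked-nonempty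
          z∈removed = picked⊆removed z∈picked
      in z , x∈p∩q⁺ (removed⊆U z∈removed , z∈removed)

  HalfIndeque : Graph n → Subset n → Set
  HalfIndeque G U = ∃[ S ] S ⊆ U × IsIndeque G S × ∣ U ∣ ≤ ∣ S ∣ + ∣ S ∣

  module _ {G : Graph n} where

    halfIndeque-empty : ∀ {U} → Empty U → HalfIndeque G U
    halfIndeque-empty {U} empty rewrite Empty-unique empty =
      ⊥ , (λ z∈⊥ → contradiction z∈⊥ ∉⊥) , ⊥-indeque {G = G} , m≤m+n _ _

    halfIndeque-peel : ∀ {U} (P : Peeling G U) → HalfIndeque G (U ─ Peeling.removed P) →
                       HalfIndeque G U
    halfIndeque-peel {U} P (S , S⊆rest , S-indeque , rest-bound) =
      picked ∪ S , picked∪S⊆U , ∪-indeque {G = G} picked-indeque S-indeque apart , bound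
      where
      open Peeling P
      S-unremoved : ∀ {b} → b ∈ S → b ∉ removed
      S-unremoved b∈S = x∈p─q⇒x∉q (S⊆rest b∈S)

      picked∪S⊆U : picked ∪ S ⊆ U
      picked∪S⊆U z∈ with x∈p∪q⁻ picked S z∈
      ... | inj₁ z∈picked = removed⊆U (picked⊆removed z∈picked)
      ... | inj₂ z∈S      = p─q⊆p U removed (S⊆rest z∈S)

      apart : ∀ {a b} → a ∈ picked → b ∈ S → ¬ Adj⁼ G a b
      apart a∈ b∈S (inj₁ refl) = S-unremoved b∈S (picked⊆removed a∈)
      apart a∈ b∈S (inj₂ ab)   =
        S-unremoved b∈S (removed-closed a∈ (p─q⊆p U removed (S⊆rest b∈S)) ab)

      ∣picked∪S∣ : ∣ picked ∪ S ∣ ≡ ∣ picked ∣ + ∣ S ∣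
      ∣picked∪S∣ = ∣p∪q∣≡∣p∣+∣q∣ picked S λ a∈ a∈S → S-unremoved a∈S (picked⊆removed a∈)

      bound : ∣ U ∣ ≤ ∣ picked ∪ S ∣ + ∣ picked ∪ S ∣
      bound = begin
        ∣ U ∣                                               ≤⟨ ∣p∣≤∣q∣+∣p─q∣ U removed ⟩
        ∣ removed ∣ + ∣ U ─ removed ∣                         ≤⟨ +-mono-≤ removed-small rest-bound ⟩
        (∣ picked ∣ + ∣ picked ∣) + (∣ S ∣ + ∣ S ∣)           ≡⟨ interchange (∣ picked ∣) _ (∣ S ∣) _ ⟩
        (∣ picked ∣ + ∣ S ∣) + (∣ picked ∣ + ∣ S ∣)           ≡⟨ sym (cong₂ _+_ ∣picked∪S∣ ∣picked∪S∣) ⟩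
        ∣ picked ∪ S ∣ + ∣ picked ∪ S ∣                       ∎
        where open ≤-Reasoning

    halfIndeque : (∀ U → Nonempty U → Peeling G U) → ∀ U → HalfIndeque G U
    halfIndeque peel U = go U (<-wellFounded ∣ U ∣)
      where
      go : ∀ U → Acc _<_ ∣ U ∣ → HalfIndeque G U
      go U (acc smaller) with nonempty? U
      ... | no  empty = halfIndeque-empty empty
      ... | yes ne    =
        halfIndeque-peel P (go (U ─ removed) (smaller (p∩q≢∅⇒∣p─q∣<∣p∣ U removed removes-some)))
        where
        P = peel U ne
        open Peeling P

    peel-lone : ∀ {U x} → x ∈ U → U ⊆ ⁅ x ⁆ → Peeling G U
    peel-lone {U} {x} x∈U U⊆x = record
      { picked          = ⁅ x ⁆
      ; removed         = U
      ; picked⊆removed  = λ z∈x → subst (_∈ U) (sym (x∈⁅y⁆⇒x≡y x z∈x)) x∈U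
      ; removed⊆U       = λ z∈U → z∈U
      ; picked-indeque  = indeque-⊆pair {G = G} {y = x} (inj₁ ∘ x∈⁅y⁆⇒x≡y x)
      ; picked-nonempty = x , x∈⁅x⁆ x
      ; removed-small   = ≤-trans (p⊆q⇒∣p∣≤∣q∣ U⊆x) (m≤m+n _ _)
      ; removed-closed  = λ _ w∈U _ → w∈U
      }

  module Elimination {G : Graph n} (D : PathDecomposition G r) where

    OccursFrom : ℕ → Fin n → Set
    OccursFrom p z = ∃[ j ] p ≤ toℕ j × z ∈ bag D j

    occursFrom? : ∀ p → Decidable (OccursFrom p)
    occursFrom? p z = any? λ j → (p ≤? toℕ j) ×-dec (z ∈? bag D j)

    PresentFrom : ℕ → Subset n → Set
    PresentFrom p = Lift (OccursFrom p)

    EndsAt : Fin n → Fin r → Set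
    EndsAt x q = x ∈ bag D q × (∀ j → toℕ q < toℕ j → x ∉ bag D j)

    EndsFirst : Subset n → Fin n → Fin r → Set
    EndsFirst U x q = x ∈ U × EndsAt x q × PresentFrom (toℕ q) U

    presentFrom-zero : ∀ U → PresentFrom 0 U
    presentFrom-zero U {z} _ = let (j , z∈j) = covers-v D z in j , z≤n , z∈j

    presentFrom-⊆ : ∀ {p U V} → V ⊆ U → PresentFrom p U → PresentFrom p V
    presentFrom-⊆ V⊆U present z∈V = present (V⊆U z∈V)

    presentFrom-suc-or-gone : ∀ p U →
      PresentFrom (suc p) U ⊎ ∃[ w ] w ∈ U × (∀ j → p < toℕ j → w ∉ bag D j)
    presentFrom-suc-or-gone p U with any? (λ w → (w ∈? U) ×-dec ¬? (occursFrom? (suc p) w))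
    ... | yes (w , w∈U , absent) = inj₂ (w , w∈U , λ j p<j w∈j → absent (j , p<j , w∈j))
    ... | no  none               =
      inj₁ λ {z} z∈U → decidable-stable (occursFrom? (suc p) z) λ absent → none (z , z∈U , absent)

    earliestEnd-within : ∀ k {p U z} → r ≤ k + p → PresentFrom p U → z ∈ U →
                         ∃[ q ] ∃[ x ] p ≤ toℕ q × EndsFirst U x q
    earliestEnd-within zero r≤p present z∈U =
      let (j , p≤j , _) = present z∈U in contradiction (<-≤-trans (toℕ<n j) r≤p) (≤⇒≯ p≤j)
    earliestEnd-within (suc k) {p} {U} r≤ present z∈U with presentFrom-suc-or-gone p U
    ... | inj₁ present′ =
      let (q , x , p<q , first) = earliestEnd-within k (subst (r ≤_) (sym (+-suc k p)) r≤) present′ z∈U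
      in q , x , <⇒≤ p<q , first
    ... | inj₂ (x , x∈U , gone) with q , p≤q , x∈q ← present x∈U =
      q , x , p≤q , x∈U , (x∈q , λ j q<j → gone j (≤-<-trans p≤q q<j)) , presentFrom-q
      where
      presentFrom-q : PresentFrom (toℕ q) U
      presentFrom-q z∈U =
        let (j , p≤j , z∈j) = present z∈U in j , ≤-trans (≮⇒≥ λ p<q → gone q p<q x∈q) p≤j , z∈j

    earliestEnd : ∀ {p U z} → PresentFrom p U → z ∈ U → ∃[ q ] ∃[ x ] p ≤ toℕ q × EndsFirst U x q
    earliestEnd {p} = earliestEnd-within r (m≤m+n r p)

    neighbour-in-last-bag : ∀ {U x y q} → EndsFirst U x q → y ∈ U → Adj G x y → y ∈ bag D q
    neighbour-in-last-bag {y = y} {q} (_ , (x∈q , x-gone) , present) y∈U xy =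
      let (k , x∈k , y∈k) = covers-e D _ y xy
          (j , q≤j , y∈j) = present y∈U
      in interval D y k q j (≮⇒≥ λ q<k → x-gone k q<k x∈k) q≤j y∈k y∈j

    -- Neighbours of x stay present until q′, so they are in the last bag of y as well.
    pair-neighbours : ∀ {U x y q q′} → EndsFirst U x q → EndsFirst (U - x) y q′ → toℕ q ≤ toℕ q′ →
                      ∀ {u w} → u ∈ ⁅ x ⁆ ∪ ⁅ y ⁆ → w ∈ U → Adj G u w → w ∈ ⁅ x ⁆ ∪ (bag D q′ ∩ U)
    pair-neighbours {x = x} x-first y-first q≤q′ {w = w} u∈ w∈U uw with x∈⁅x⁆∪⁅y⁆⁻ u∈ | w ≟ x
    ... | _         | yes refl = x∈p∪q⁺ (inj₁ (x∈⁅x⁆ x))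
    ... | inj₁ refl | no  w≢x  =
      let (j , q′≤j , w∈j) = proj₂ (proj₂ y-first) (x∈p∧x≢y⇒x∈p-y w∈U w≢x)
          w∈q = neighbour-in-last-bag x-first w∈U uw
      in x∈p∪q⁺ (inj₂ (x∈p∩q⁺ (interval D _ _ _ j q≤q′ q′≤j w∈q w∈j , w∈U)))
    ... | inj₂ refl | no  w≢x  =
      x∈p∪q⁺ (inj₂ (x∈p∩q⁺ (neighbour-in-last-bag y-first (x∈p∧x≢y⇒x∈p-y w∈U w≢x) uw , w∈U)))

    peel-pair : Narrow 2 D → ∀ {U x y q q′} →
                EndsFirst U x q → EndsFirst (U - x) y q′ → toℕ q ≤ toℕ q′ → Peeling G U
    peel-pair narrow {U} {x} {y} {q} {q′} x-first@(x∈U , _) y-first@(y∈U-x , y-ends , _) q≤q′ = record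
      { picked          = ⁅ x ⁆ ∪ ⁅ y ⁆
      ; removed         = ⁅ x ⁆ ∪ (bag D q′ ∩ U)
      ; picked⊆removed  = picked⊆removed
      ; removed⊆U       = removed⊆U
      ; picked-indeque  = indeque-⊆pair {G = G} x∈⁅x⁆∪⁅y⁆⁻
      ; picked-nonempty = x , x∈p∪q⁺ (inj₁ (x∈⁅x⁆ x))
      ; removed-small   = removed-small
      ; removed-closed  = pair-neighbours x-first y-first q≤q′
      }
      where
      picked⊆removed : ⁅ x ⁆ ∪ ⁅ y ⁆ ⊆ ⁅ x ⁆ ∪ (bag D q′ ∩ U)
      picked⊆removed z∈ with x∈⁅x⁆∪⁅y⁆⁻ z∈
      ... | inj₁ refl = x∈p∪q⁺ (inj₁ (x∈⁅x⁆ x))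
      ... | inj₂ refl = x∈p∪q⁺ (inj₂ (x∈p∩q⁺ (proj₁ y-ends , p─q⊆p U ⁅ x ⁆ y∈U-x)))

      removed⊆U : ⁅ x ⁆ ∪ (bag D q′ ∩ U) ⊆ U
      removed⊆U z∈ with x∈p∪q⁻ ⁅ x ⁆ _ z∈
      ... | inj₁ z∈x   = subst (_∈ U) (sym (x∈⁅y⁆⇒x≡y x z∈x)) x∈U
      ... | inj₂ z∈q′U = proj₂ (x∈p∩q⁻ _ _ z∈q′U)

      removed-small : ∣ ⁅ x ⁆ ∪ (bag D q′ ∩ U) ∣ ≤ ∣ ⁅ x ⁆ ∪ ⁅ y ⁆ ∣ + ∣ ⁅ x ⁆ ∪ ⁅ y ⁆ ∣
      removed-small rewrite ∣⁅x⁆∪⁅y⁆∣≡2 (x∉⁅y⁆⇒x≢y (x∈p─q⇒x∉q y∈U-x) ∘ sym) = begin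
        ∣ ⁅ x ⁆ ∪ (bag D q′ ∩ U) ∣    ≤⟨ ∣p∪q∣≤∣p∣+∣q∣ ⁅ x ⁆ _ ⟩
        ∣ ⁅ x ⁆ ∣ + ∣ bag D q′ ∩ U ∣  ≤⟨ +-mono-≤ (≤-reflexive (∣⁅x⁆∣≡1 x))
                                                 (≤-trans (∣p∩q∣≤∣p∣ (bag D q′) U) (narrow q′)) ⟩
        4                             ∎
        where open ≤-Reasoning

    peel : Narrow 2 D → ∀ U → Nonempty U → Peeling G U
    peel narrow U (z , z∈U) with earliestEnd (presentFrom-zero U) z∈U
    ... | q , x , _ , x-first@(x∈U , _ , present) with nonempty? (U - x)
    ... | no  only-x = peel-lone x∈U (Empty[p-x]⇒p⊆⁅x⁆ only-x)
    ... | yes (z′ , z′∈U-x) with earliestEnd (presentFrom-⊆ (p─q⊆p U ⁅ x ⁆) present) z′∈U-x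
    ... | q′ , y , q≤q′ , y-first = peel-pair narrow x-first y-first q≤q′

  indequeNumber-≥half : ∀ {G : Graph n} {k} → PathwidthAtMost 2 G → IsIndequeNumber G k → n ≤ k + k
  indequeNumber-≥half {n} (_ , D , narrow) (_ , maximal)
    with S , _ , S-indeque , bound ← halfIndeque (Elimination.peel D narrow) ⊤ = begin
    n             ≡⟨ sym (∣⊤∣≡n n) ⟩
    ∣ ⊤ {n} ∣     ≤⟨ bound ⟩
    ∣ S ∣ + ∣ S ∣ ≤⟨ +-mono-≤ (maximal S S-indeque) (maximal S S-indeque) ⟩
    _             ∎
    where open ≤-Reasoning

module Search where

  open Subsets
  open Basics
  open import Data.Nat using (_<_)
  open import Data.Fin using (inject₁; punchIn; punchOut; fromℕ<)
  open import Data.Fin.Properties using (pigeonhole; punchIn-punchOut; punchIn-mono-≤; toℕ-inject₁; toℕ-fromℕ<)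
  open import Data.Fin.Subset
  open import Data.Fin.Subset.Properties
  open import Data.Vec using (tabulate)
  open import Data.Vec.Properties using (lookup∘tabulate)
  open import Data.Sum using (map₂)
  open import Relation.Binary.PropositionalEquality using (_≗_)

  private variable
    n r : ℕ
    A : Set
    G H : Graph n

  Searchable : Set → Set₁
  Searchable A = ∀ {P : Pred A 0ℓ} → Decidable P → Dec (∃ P)

  all-searchable : Searchable A → ∀ {P : Pred A 0ℓ} → Decidable P → Dec (∀ a → P a)
  all-searchable search P? with search (¬? ∘ P?)
  ... | yes (a , ¬Pa) = no λ all → ¬Pa (all a)
  ... | no  none      = yes λ a → decidable-stable (P? a) λ ¬Pa → none (a , ¬Pa)

  Vec-searchable : Searchable A → ∀ r → Searchable (Vec A r)
  Vec-searchable search zero    P? = map′ ([] ,_) (λ { ([] , P[]) → P[] }) (P? [])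
  Vec-searchable search (suc r) P? =
    map′ (λ (a , as , P) → a ∷ as , P) (λ { (a ∷ as , P) → a , as , P })
         (search λ a → Vec-searchable search r (P? ∘ (a ∷_)))

  Subset-searchable : Searchable (Subset n)
  Subset-searchable = anySubset?

  module _ (G : Graph n) where

    Adj? : ∀ u v → Dec (Adj G u v)
    Adj? u v = adj G u v Bool.≟ true

    Adj⁼? : ∀ u v → Dec (Adj⁼ G u v)
    Adj⁼? u v = (u ≟ v) ⊎-dec Adj? u v

    indeque? : Decidable (IsIndeque G)
    indeque? S = all? λ u → all? λ v → all? λ w →
      (u ∈? S) →-dec (v ∈? S) →-dec (w ∈? S) →-dec Adj⁼? u v →-dec Adj⁼? v w →-dec Adj⁼? u w

    indequeAtMost? : Decidable (IndequeAtMost G)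
    indequeAtMost? k = all-searchable Subset-searchable λ S → indeque? S →-dec (∣ S ∣ ≤? k)

    isIndequeNumber? : Decidable (IsIndequeNumber G)
    isIndequeNumber? k =
      Subset-searchable (λ S → indeque? S ×-dec (∣ S ∣ Data.Nat.≟ k)) ×-dec indequeAtMost? k

    indequeNumber-below : ∀ k → IndequeAtMost G k → ∃ (IsIndequeNumber G)
    indequeNumber-below k atMost with Subset-searchable (λ S → indeque? S ×-dec (∣ S ∣ Data.Nat.≟ k))
    ... | yes attained = k , attained , atMost
    indequeNumber-below zero    atMost | no unattained =
      contradiction (⊥ , ⊥-indeque {G = G} , ∣⊥∣≡0 n) unattained
    indequeNumber-below (suc k) atMost | no unattained =
      indequeNumber-below k λ S S-indeque →
        ≤-pred (≤∧≢⇒< (atMost S S-indeque) λ ∣S∣≡k → unattained (S , S-indeque , ∣S∣≡k))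

    indequeNumber : ∃ (IsIndequeNumber G)
    indequeNumber = indequeNumber-below n λ S _ → ∣p∣≤n S

  punchIn-inject₁-self : (i : Fin (suc r)) → punchIn (inject₁ i) i ≡ suc i
  punchIn-inject₁-self         zero    = refl
  punchIn-inject₁-self {suc r} (suc i) = cong suc (punchIn-inject₁-self i)

  module _ {G : Graph n} where

    drop-bag : ∀ {w} (D : PathDecomposition G (suc (suc r))) (i : Fin (suc r)) →
               bag D (inject₁ i) ⊆ bag D (suc i) → Narrow w D →
               Σ (PathDecomposition G (suc r)) (Narrow w)
    drop-bag {r} D i redundant narrow = D′ , narrow ∘ skip
      where
      skip : Fin (suc r) → Fin (suc (suc r))
      skip = punchIn (inject₁ i)

      relocate : ∀ k → ∃[ j ] bag D k ⊆ bag D (skip j)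
      relocate k with inject₁ i ≟ k
      ... | yes refl = i , λ v∈ → subst (λ t → _ ∈ bag D t) (sym (punchIn-inject₁-self i)) (redundant v∈)
      ... | no  i≢k  = punchOut i≢k , λ v∈ → subst (λ t → _ ∈ bag D t) (sym (punchIn-punchOut i≢k)) v∈

      D′ : PathDecomposition G (suc r)
      D′ = record
        { bag      = bag D ∘ skip
        ; covers-v = λ v → let (k , v∈k) = covers-v D v
                               (j , k⊆j) = relocate k
                           in j , k⊆j v∈k
        ; covers-e = λ u v uv → let (k , u∈k , v∈k) = covers-e D u v uv
                                    (j , k⊆j) = relocate k
                                in j , k⊆j u∈k , k⊆j v∈k
        ; interval = λ v j₁ j₂ j₃ j₁≤j₂ j₂≤j₃ →
            interval D v _ _ _ (punchIn-mono-≤ (inject₁ i) j₁ j₂ j₁≤j₂)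
                               (punchIn-mono-≤ (inject₁ i) j₂ j₃ j₂≤j₃)
        }

    -- A vertex leaving after bag i never returns, so distinct i have distinct leaving vertices.
    redundant-bag : (D : PathDecomposition G (suc (suc r))) → n < suc r →
                    ∃[ i ] bag D (inject₁ i) ⊆ bag D (suc i)
    redundant-bag {r} D n<r+1 with any? (λ i → bag D (inject₁ i) ⊆? bag D (suc i))
    ... | yes found = found
    ... | no  none  =
      let (i , j , i<j , same) = pigeonhole n<r+1 (proj₁ ∘ leaving)
          (v , v∈i , v∉i+1)   = leaving i
          v∈j = subst (_∈ bag D (inject₁ j)) (sym same) (proj₁ (proj₂ (leaving j)))
          i≤i+1 = ≤-trans (≤-reflexive (toℕ-inject₁ i)) (n≤1+n _)
          i+1≤j = subst (suc (toℕ i) ≤_) (sym (toℕ-inject₁ j)) i<j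
      in contradiction (interval D v (inject₁ i) (suc i) (inject₁ j) i≤i+1 i+1≤j v∈i v∈j) v∉i+1
      where
      leaving : ∀ i → ∃[ v ] v ∈ bag D (inject₁ i) × v ∉ bag D (suc i)
      leaving i = p⊈q⇒∃x∈p∧x∉q λ ⊆ → none (i , ⊆)

    few-bags : ∀ {w} r (D : PathDecomposition G r) → Narrow w D →
               ∃[ r′ ] r′ ≤ suc n × Σ (PathDecomposition G r′) (Narrow w)
    few-bags zero    D narrow = zero , z≤n , D , narrow
    few-bags {w} (suc r) D narrow = few-bags⁺ r D narrow
      where
      -- Indexing by s for s + 1 bags makes the recursive call structural.
      few-bags⁺ : ∀ s (E : PathDecomposition G (suc s)) → Narrow w E →
                  ∃[ r′ ] r′ ≤ suc n × Σ (PathDecomposition G r′) (Narrow w)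
      few-bags⁺ zero    E narrow = suc zero , s≤s z≤n , E , narrow
      few-bags⁺ (suc s) E narrow with suc (suc s) ≤? suc n
      ... | yes few  = suc (suc s) , few , E , narrow
      ... | no  many with i , redundant ← redundant-bag E (≤-pred (≰⇒> many))
                     with E′ , narrow′ ← drop-bag E i redundant narrow
        = few-bags⁺ s E′ narrow′

  module _ (G : Graph n) (w : ℕ) where

    IsNarrowDecomposition : (Fin r → Subset n) → Set
    IsNarrowDecomposition {r} B =
      (∀ v → ∃[ i ] v ∈ B i) ×
      (∀ u v → Adj G u v → ∃[ i ] u ∈ B i × v ∈ B i) ×
      (∀ v (i j k : Fin r) → i Fin.≤ j → j Fin.≤ k → v ∈ B i → v ∈ B k → v ∈ B j) ×
      (∀ i → ∣ B i ∣ ≤ w + 1)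

    isNarrowDecomposition? : (bs : Vec (Subset n) r) → Dec (IsNarrowDecomposition (lookup bs))
    isNarrowDecomposition? bs =
      (all? λ v → any? λ i → v ∈? B i) ×-dec
      (all? λ u → all? λ v → Adj? G u v →-dec any? λ i → (u ∈? B i) ×-dec (v ∈? B i)) ×-dec
      (all? λ v → all? λ i → all? λ j → all? λ k →
         (i Fin.≤? j) →-dec (j Fin.≤? k) →-dec (v ∈? B i) →-dec (v ∈? B k) →-dec (v ∈? B j)) ×-dec
      (all? λ i → ∣ B i ∣ ≤? w + 1)
      where B = lookup bs

    isNarrowDecomposition-cong : {B C : Fin r → Subset n} → B ≗ C →
                                 IsNarrowDecomposition B → IsNarrowDecomposition C
    isNarrowDecomposition-cong {C = C} B≗C (covers-v , covers-e , interval , narrow) =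
      (λ v → let (i , v∈) = covers-v v in i , to i v∈) ,
      (λ u v uv → let (i , u∈ , v∈) = covers-e u v uv in i , to i u∈ , to i v∈) ,
      (λ v i j k i≤j j≤k v∈i v∈k → to j (interval v i j k i≤j j≤k (from i v∈i) (from k v∈k))) ,
      (λ i → subst (λ b → ∣ b ∣ ≤ w + 1) (B≗C i) (narrow i))
      where
      to : ∀ i {v} → v ∈ _ → v ∈ C i
      to i = subst (_ ∈_) (B≗C i)
      from : ∀ i {v} → v ∈ C i → v ∈ _
      from i = subst (_ ∈_) (sym (B≗C i))

    narrowDecomposition⇒pathwidth : {B : Fin r → Subset n} → IsNarrowDecomposition B →
                                    PathwidthAtMost w G
    narrowDecomposition⇒pathwidth {r} {B} (covers-v , covers-e , interval , narrow) =
      r , record { bag = B ; covers-v = covers-v ; covers-e = covers-e ; interval = interval } , narrow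

    NarrowBagVector : ℕ → Set
    NarrowBagVector r = ∃ λ (bs : Vec (Subset n) r) → IsNarrowDecomposition (lookup bs)

    pathwidth⇒narrowBagVector : PathwidthAtMost w G → ∃[ r ] r ≤ suc n × NarrowBagVector r
    pathwidth⇒narrowBagVector (r , D , narrow) =
      let (r′ , r′≤n+1 , D′ , narrow′) = few-bags r D narrow
      in r′ , r′≤n+1 , tabulate (bag D′) ,
         isNarrowDecomposition-cong (sym ∘ lookup∘tabulate (bag D′))
                                    (covers-v D′ , covers-e D′ , interval D′ , narrow′)

    pathwidth? : Dec (PathwidthAtMost w G)
    pathwidth? =
      map′ (λ (_ , _ , decomposition) → narrowDecomposition⇒pathwidth decomposition)
           (λ pw → let (r , r≤n+1 , bags) = pathwidth⇒narrowBagVector pw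
                   in fromℕ< (s≤s r≤n+1) , subst NarrowBagVector (sym (toℕ-fromℕ< (s≤s r≤n+1))) bags)
           (any? {suc (suc n)} λ r → Vec-searchable Subset-searchable (toℕ r) isNarrowDecomposition?)

  record SameAdj (G H : Graph n) : Set where
    constructor sameAdj
    field adj-≡ : ∀ u v → adj G u v ≡ adj H u v
  open SameAdj

  SameAdj-sym : SameAdj G H → SameAdj H G
  SameAdj-sym same = sameAdj λ u v → sym (adj-≡ same u v)

  Adj-transport : SameAdj G H → ∀ {u v} → Adj G u v → Adj H u v
  Adj-transport same {u} {v} = trans (sym (adj-≡ same u v))

  isIndeque-transport : SameAdj G H → ∀ {S} → IsIndeque G S → IsIndeque H S
  isIndeque-transport same S-indeque u v w u∈ v∈ w∈ uv vw =
    map₂ (Adj-transport same)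
      (S-indeque u v w u∈ v∈ w∈ (map₂ (Adj-transport (SameAdj-sym same)) uv)
                                (map₂ (Adj-transport (SameAdj-sym same)) vw))

  isIndequeNumber-transport : SameAdj G H → ∀ {k} → IsIndequeNumber G k → IsIndequeNumber H k
  isIndequeNumber-transport same ((S , S-indeque , ∣S∣≡k) , maximal) =
    (S , isIndeque-transport same S-indeque , ∣S∣≡k) ,
    λ T T-indeque → maximal T (isIndeque-transport (SameAdj-sym same) T-indeque)

  pathwidth-transport : SameAdj G H → ∀ {w} → PathwidthAtMost w G → PathwidthAtMost w H
  pathwidth-transport same (r , D , narrow) =
    r , record { bag      = bag D
               ; covers-v = covers-v D
               ; covers-e = λ u v uv → covers-e D u v (Adj-transport (SameAdj-sym same) uv)
               ; interval = interval D } ,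
    narrow

  rows : Graph n → Vec (Subset n) n
  rows G = tabulate λ u → tabulate (adj G u)

  lookup-rows : (G : Graph n) → ∀ u v → lookup (lookup (rows G) u) v ≡ adj G u v
  lookup-rows G u v = trans (cong (λ row → lookup row v) (lookup∘tabulate _ u)) (lookup∘tabulate _ v)

  module _ (M : Vec (Subset n) n) where

    Symmetric Irreflexive : Set
    Symmetric   = ∀ u v → lookup (lookup M u) v ≡ lookup (lookup M v) u
    Irreflexive = ∀ v → lookup (lookup M v) v ≡ false

    fromRows : Symmetric → Irreflexive → Graph n
    fromRows symmetric irreflexive = record
      { adj = λ u v → lookup (lookup M u) v ; sym = symmetric ; irrefl = irreflexive }

  rows-symmetric : (G : Graph n) → Symmetric (rows G)
  rows-symmetric G u v = trans (lookup-rows G u v) (trans (Graph.sym G u v) (sym (lookup-rows G v u)))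

  rows-irreflexive : (G : Graph n) → Irreflexive (rows G)
  rows-irreflexive G v = trans (lookup-rows G v v) (irrefl G v)

  Graph-search : {P : Pred (Graph n) 0ℓ} → (∀ {G H} → SameAdj G H → P G → P H) → Decidable P → Dec (∃ P)
  Graph-search {n} {P} respects P? =
    map′ (λ (M , symmetric , irreflexive , p) → fromRows M symmetric irreflexive , p)
         (λ (G , p) → rows G , rows-symmetric G , rows-irreflexive G ,
                      respects (sameAdj λ u v → sym (lookup-rows G u v)) p)
         (Vec-searchable Subset-searchable n λ M →
            decide M (all? λ u → all? λ v → lookup (lookup M u) v Bool.≟ lookup (lookup M v) u)
                     (all? λ v → lookup (lookup M v) v Bool.≟ false))
    where
    decide : ∀ M → Dec (Symmetric M) → Dec (Irreflexive M) →
             Dec (Σ (Symmetric M) λ s → Σ (Irreflexive M) λ i → P (fromRows M s i))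
    decide M (yes s) (yes i) =
      map′ (λ p → s , i , p) (λ (_ , _ , p) → respects (sameAdj λ _ _ → refl) p) (P? (fromRows M s i))
    decide M (no ¬s) _       = no λ (s , _) → ¬s s
    decide M _       (no ¬i) = no λ (_ , i , _) → ¬i i

module UpperBound where

  open Subsets
  open Basics
  open Search
  open import Data.Nat using (_<_)
  open import Data.Bool.Properties using (xor-comm; xor-same)
  open import Data.Fin using (splitAt; _↑ˡ_; _↑ʳ_)
  open import Data.Fin.Properties
    using (splitAt-↑ˡ; splitAt-↑ʳ; splitAt⁻¹-↑ˡ; splitAt⁻¹-↑ʳ; ↑ˡ-injective; ↑ʳ-injective; toℕ-↑ˡ; toℕ-↑ʳ; toℕ<n)
  open import Data.Fin.Subset
  open import Data.Fin.Subset.Properties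
  open import Data.Vec using (_++_; take; drop)
  open import Data.Vec.Properties using (take++drop≡id)
  open import Data.Sum using ([_,_]′)

  private variable
    m n k : ℕ

  data Summand (m k : ℕ) : Fin (m + k) → Set where
    left  : (i : Fin m) → Summand m k (i ↑ˡ k)
    right : (j : Fin k) → Summand m k (m ↑ʳ j)

  summand : ∀ m {k} (u : Fin (m + k)) → Summand m k u
  summand m u with splitAt m u in eq
  ... | inj₁ i = subst (Summand m _) (splitAt⁻¹-↑ˡ eq) (left i)
  ... | inj₂ j = subst (Summand m _) (splitAt⁻¹-↑ʳ eq) (right j)

  sumAdj : Graph m → Graph k → Fin m ⊎ Fin k → Fin m ⊎ Fin k → Bool
  sumAdj G H (inj₁ i) (inj₁ j) = adj G i j
  sumAdj G H (inj₂ i) (inj₂ j) = adj H i j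
  sumAdj G H _        _        = false

  infixr 5 _⊕_
  _⊕_ : Graph m → Graph k → Graph (m + k)
  _⊕_ {m} G H = record
    { adj    = λ u v → sumAdj G H (splitAt m u) (splitAt m v)
    ; sym    = λ u v → symmetric (splitAt m u) (splitAt m v)
    ; irrefl = λ u → irreflexive (splitAt m u)
    }
    where
    symmetric : ∀ x y → sumAdj G H x y ≡ sumAdj G H y x
    symmetric (inj₁ i) (inj₁ j) = Graph.sym G i j
    symmetric (inj₂ i) (inj₂ j) = Graph.sym H i j
    symmetric (inj₁ _) (inj₂ _) = refl
    symmetric (inj₂ _) (inj₁ _) = refl
    irreflexive : ∀ x → sumAdj G H x x ≡ false
    irreflexive (inj₁ i) = irrefl G i
    irreflexive (inj₂ j) = irrefl H j

  module _ (G : Graph m) (H : Graph k) where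

    adj-⊕-ˡ : ∀ i j → adj (G ⊕ H) (i ↑ˡ k) (j ↑ˡ k) ≡ adj G i j
    adj-⊕-ˡ i j rewrite splitAt-↑ˡ m i k | splitAt-↑ˡ m j k = refl

    adj-⊕-ʳ : ∀ i j → adj (G ⊕ H) (m ↑ʳ i) (m ↑ʳ j) ≡ adj H i j
    adj-⊕-ʳ i j rewrite splitAt-↑ʳ m k i | splitAt-↑ʳ m k j = refl

    adj-⊕-ˡʳ : ∀ i j → adj (G ⊕ H) (i ↑ˡ k) (m ↑ʳ j) ≡ false
    adj-⊕-ˡʳ i j rewrite splitAt-↑ˡ m i k | splitAt-↑ʳ m k j = refl

  ⊕-indequeAtMost : ∀ {G : Graph m} {H : Graph k} {a b} →
    IndequeAtMost G a → IndequeAtMost H b → IndequeAtMost (G ⊕ H) (a + b)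
  ⊕-indequeAtMost {m} {k} {G} {H} {a} {b} G-atMost H-atMost S S-indeque = begin
    ∣ S ∣             ≡⟨ cong ∣_∣ (sym split) ⟩
    ∣ L ++ R ∣        ≡⟨ ∣A++B∣≡∣A∣+∣B∣ L R ⟩
    ∣ L ∣ + ∣ R ∣     ≤⟨ +-mono-≤ (G-atMost L L-indeque) (H-atMost R R-indeque) ⟩
    a + b             ∎
    where
    open ≤-Reasoning
    L = take m S
    R = drop m S
    split : L ++ R ≡ S
    split = take++drop≡id m S
    L-indeque : IsIndeque G L
    L-indeque = indeque-preimage {G = G} {H = G ⊕ H} (_↑ˡ k) (↑ˡ-injective k _ _) (adj-⊕-ˡ G H)
                  {S = S} S-indeque (subst (_ ∈_) split ∘ ∈-++⁺ˡ)
    R-indeque : IsIndeque H R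
    R-indeque = indeque-preimage {G = H} {H = G ⊕ H} (m ↑ʳ_) (↑ʳ-injective m _ _) (adj-⊕-ʳ G H)
                  {S = S} S-indeque (subst (_ ∈_) split ∘ ∈-++⁺ʳ L)

  ↑ˡ<↑ʳ : ∀ (i : Fin m) (j : Fin k) → toℕ (i ↑ˡ k) < toℕ (m ↑ʳ j)
  ↑ˡ<↑ʳ {m} {k} i j rewrite toℕ-↑ˡ i k | toℕ-↑ʳ m j = ≤-trans (toℕ<n i) (m≤m+n m (toℕ j))

  module ⊕-Decomposition {G : Graph m} {H : Graph k} {r₁ r₂}
                         (D₁ : PathDecomposition G r₁) (D₂ : PathDecomposition H r₂) where

    bags : Fin (r₁ + r₂) → Subset (m + k)
    bags t = [ (λ i → bag D₁ i ++ ⊥) , (λ j → ⊥ ++ bag D₂ j) ]′ (splitAt r₁ t)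

    bags-ˡ : ∀ i → bags (i ↑ˡ r₂) ≡ bag D₁ i ++ ⊥
    bags-ˡ i rewrite splitAt-↑ˡ r₁ i r₂ = refl

    bags-ʳ : ∀ j → bags (r₁ ↑ʳ j) ≡ ⊥ ++ bag D₂ j
    bags-ʳ j rewrite splitAt-↑ʳ r₁ r₂ j = refl

    inˡ : ∀ {u i} → u ∈ bag D₁ i → u ↑ˡ k ∈ bags (i ↑ˡ r₂)
    inˡ u∈ = subst (_ ∈_) (sym (bags-ˡ _)) (∈-++⁺ˡ u∈)

    inʳ : ∀ {v j} → v ∈ bag D₂ j → m ↑ʳ v ∈ bags (r₁ ↑ʳ j)
    inʳ v∈ = subst (_ ∈_) (sym (bags-ʳ _)) (∈-++⁺ʳ ⊥ v∈)

    outˡ : ∀ {u i} → u ↑ˡ k ∈ bags (i ↑ˡ r₂) → u ∈ bag D₁ i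
    outˡ u∈ = ∈-++⁻ˡ (subst (_ ∈_) (bags-ˡ _) u∈)

    outʳ : ∀ {v j} → m ↑ʳ v ∈ bags (r₁ ↑ʳ j) → v ∈ bag D₂ j
    outʳ v∈ = ∈-++⁻ʳ ⊥ (subst (_ ∈_) (bags-ʳ _) v∈)

    outˡʳ : ∀ {u j} → u ↑ˡ k ∉ bags (r₁ ↑ʳ j)
    outˡʳ u∈ = ∉⊥ (∈-++⁻ˡ (subst (_ ∈_) (bags-ʳ _) u∈))

    outʳˡ : ∀ {v i} → m ↑ʳ v ∉ bags (i ↑ˡ r₂)
    outʳˡ v∈ = ∉⊥ (∈-++⁻ʳ (bag D₁ _) (subst (_ ∈_) (bags-ˡ _) v∈))

    covers-vertices : ∀ u → ∃[ t ] u ∈ bags t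
    covers-vertices u with summand m u
    ... | left i  = let (t , i∈) = covers-v D₁ i in t ↑ˡ r₂ , inˡ i∈
    ... | right j = let (t , j∈) = covers-v D₂ j in r₁ ↑ʳ t , inʳ j∈

    covers-edges : ∀ u v → Adj (G ⊕ H) u v → ∃[ t ] u ∈ bags t × v ∈ bags t
    covers-edges u v uv with summand m u | summand m v
    ... | left i  | left j  =
      let (t , i∈ , j∈) = covers-e D₁ i j (trans (sym (adj-⊕-ˡ G H i j)) uv) in t ↑ˡ r₂ , inˡ i∈ , inˡ j∈
    ... | right i | right j =
      let (t , i∈ , j∈) = covers-e D₂ i j (trans (sym (adj-⊕-ʳ G H i j)) uv) in r₁ ↑ʳ t , inʳ i∈ , inʳ j∈
    ... | left i  | right j = contradiction (trans (sym (adj-⊕-ˡʳ G H i j)) uv) λ ()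
    ... | right i | left j  =
      contradiction (trans (sym (adj-⊕-ˡʳ G H j i)) (Adj-sym {G = G ⊕ H} uv)) λ ()

    interval-⊕ : ∀ v t₁ t₂ t₃ → toℕ t₁ ≤ toℕ t₂ → toℕ t₂ ≤ toℕ t₃ →
                 v ∈ bags t₁ → v ∈ bags t₃ → v ∈ bags t₂
    interval-⊕ v t₁ t₂ t₃ t₁≤t₂ t₂≤t₃ v∈t₁ v∈t₃
      with summand m v | summand r₁ t₁ | summand r₁ t₂ | summand r₁ t₃
    ... | left u  | left a  | left b  | left c  =
      inˡ (interval D₁ u a b c (toℕ-↑ˡ-≤ t₁≤t₂) (toℕ-↑ˡ-≤ t₂≤t₃) (outˡ v∈t₁) (outˡ v∈t₃))
      where
      toℕ-↑ˡ-≤ : ∀ {x y : Fin r₁} → toℕ (x ↑ˡ r₂) ≤ toℕ (y ↑ˡ r₂) → toℕ x ≤ toℕ y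
      toℕ-↑ˡ-≤ {x} {y} = subst₂ _≤_ (toℕ-↑ˡ x r₂) (toℕ-↑ˡ y r₂)
    ... | right u | right a | right b | right c =
      inʳ (interval D₂ u a b c (toℕ-↑ʳ-≤ t₁≤t₂) (toℕ-↑ʳ-≤ t₂≤t₃) (outʳ v∈t₁) (outʳ v∈t₃))
      where
      toℕ-↑ʳ-≤ : ∀ {x y : Fin r₂} → toℕ (r₁ ↑ʳ x) ≤ toℕ (r₁ ↑ʳ y) → toℕ x ≤ toℕ y
      toℕ-↑ʳ-≤ {x} {y} = +-cancelˡ-≤ r₁ _ _ ∘ subst₂ _≤_ (toℕ-↑ʳ r₁ x) (toℕ-↑ʳ r₁ y)
    ... | left _  | right _ | _       | _       = contradiction v∈t₁ outˡʳ
    ... | left _  | _       | _       | right _ = contradiction v∈t₃ outˡʳ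
    ... | right _ | left _  | _       | _       = contradiction v∈t₁ outʳˡ
    ... | right _ | _       | _       | left _  = contradiction v∈t₃ outʳˡ
    ... | left _  | left _  | right b | left c  = contradiction t₂≤t₃ (<⇒≱ (↑ˡ<↑ʳ c b))
    ... | right _ | right a | left b  | right _ = contradiction t₁≤t₂ (<⇒≱ (↑ˡ<↑ʳ b a))

    decomposition : PathDecomposition (G ⊕ H) (r₁ + r₂)
    decomposition = record
      { bag = bags ; covers-v = covers-vertices ; covers-e = covers-edges ; interval = interval-⊕ }

    narrow : ∀ {w} → Narrow w D₁ → Narrow w D₂ → Narrow w decomposition
    narrow narrow₁ narrow₂ t with summand r₁ t
    ... | left i rewrite bags-ˡ i | ∣A++B∣≡∣A∣+∣B∣ (bag D₁ i) (⊥ {k}) | ∣⊥∣≡0 k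
                       | +-identityʳ ∣ bag D₁ i ∣ = narrow₁ i
    ... | right j rewrite bags-ʳ j | ∣A++B∣≡∣A∣+∣B∣ (⊥ {m}) (bag D₂ j) | ∣⊥∣≡0 m = narrow₂ j

  ⊕-pathwidth : ∀ {G : Graph m} {H : Graph k} {w} →
                PathwidthAtMost w G → PathwidthAtMost w H → PathwidthAtMost w (G ⊕ H)
  ⊕-pathwidth (r₁ , D₁ , narrow₁) (r₂ , D₂ , narrow₂) =
    r₁ + r₂ , decomposition , narrow narrow₁ narrow₂
    where open ⊕-Decomposition D₁ D₂

  completeBipartite : (Fin n → Bool) → Graph n
  completeBipartite colour = record
    { adj    = λ u v → colour u xor colour v
    ; sym    = λ u v → xor-comm (colour u) (colour v)
    ; irrefl = λ v → xor-same (colour v)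
    }

  C₄ : Graph 4
  C₄ = completeBipartite (lookup (true ∷ false ∷ true ∷ false ∷ []))

  C₄-pathwidth : PathwidthAtMost 2 C₄
  C₄-pathwidth = narrowDecomposition⇒pathwidth C₄ 2 (from-yes (isNarrowDecomposition? C₄ 2 bags))
    where
    bags : Vec (Subset 4) 2
    bags = (inside ∷ inside ∷ outside ∷ inside ∷ []) ∷ (outside ∷ inside ∷ inside ∷ inside ∷ []) ∷ []

  C₄-indequeAtMost : IndequeAtMost C₄ 2
  C₄-indequeAtMost = from-yes (indequeAtMost? C₄ 2)

  edgeless : Graph n
  edgeless = record { adj = λ _ _ → false ; sym = λ _ _ → refl ; irrefl = λ _ → refl }

  pathwidth-oneBag : ∀ {G : Graph n} {w} → n ≤ w + 1 → PathwidthAtMost w G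
  pathwidth-oneBag {n} n≤w+1 =
    1 ,
    record { bag      = λ _ → ⊤
           ; covers-v = λ _ → zero , ∈⊤
           ; covers-e = λ _ _ _ → zero , ∈⊤ , ∈⊤
           ; interval = λ _ _ _ _ _ _ _ _ → ∈⊤ } ,
    λ _ → subst (_≤ _) (sym (∣⊤∣≡n n)) n≤w+1

  LowIndequeP₂ : ℕ → Set
  LowIndequeP₂ n = Σ (Graph n) λ G → PathwidthAtMost 2 G × ∃[ b ] IndequeAtMost G b × b + b ≤ n + 3

  edgeless-lowIndeque : n ≤ 3 → LowIndequeP₂ n
  edgeless-lowIndeque {n} n≤3 =
    edgeless , pathwidth-oneBag {w = 2} n≤3 , n , (λ S _ → ∣p∣≤n S) , +-monoʳ-≤ n n≤3

  C₄-forest : ∀ n → LowIndequeP₂ n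
  C₄-forest 0 = edgeless-lowIndeque z≤n
  C₄-forest 1 = edgeless-lowIndeque (s≤s z≤n)
  C₄-forest 2 = edgeless-lowIndeque (s≤s (s≤s z≤n))
  C₄-forest 3 = edgeless-lowIndeque (s≤s (s≤s (s≤s z≤n)))
  C₄-forest (suc (suc (suc (suc n)))) =
    let (G , G-pathwidth , b , G-atMost , b+b≤n+3) = C₄-forest n
    in C₄ ⊕ G , ⊕-pathwidth {w = 2} C₄-pathwidth G-pathwidth , 2 + b ,
       ⊕-indequeAtMost C₄-indequeAtMost G-atMost ,
       ≤-trans (≤-reflexive (interchange 2 b 2 b)) (+-monoʳ-≤ 4 b+b≤n+3)

module Minimum where

  open LowerBound using (indequeNumber-≥half)
  open Search
  open UpperBound using (C₄-forest)

  least : {P : Pred ℕ 0ℓ} → Decidable P → ∀ {k} → P k → ∃[ m ] P m × (∀ {j} → P j → m ≤ j)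
  least P? {k} Pk with P? 0
  ... | yes P0 = 0 , P0 , λ _ → z≤n
  least P? {zero}  P0 | no ¬P0 = contradiction P0 ¬P0
  least P? {suc k} Pk | no ¬P0 with m , Pm , minimal ← least (P? ∘ suc) Pk =
    suc m , Pm , λ { {zero} P0 → contradiction P0 ¬P0 ; {suc j} Pj → s≤s (minimal Pj) }

  RealisedInP₂ : ℕ → ℕ → Set
  RealisedInP₂ n k = Σ (Graph n) λ G → PathwidthAtMost 2 G × IsIndequeNumber G k

  realisedInP₂? : ∀ n → Decidable (RealisedInP₂ n)
  realisedInP₂? n k =
    Graph-search (λ same (pw , ι) → pathwidth-transport same {w = 2} pw ,
                                    isIndequeNumber-transport same ι)
                 (λ G → pathwidth? G 2 ×-dec isIndequeNumber? G k)

  minIndequeP2-≤ : ∀ {n k} → RealisedInP₂ n k → ∃[ m ] IsMinIndequeP2 n m × m ≤ k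
  minIndequeP2-≤ {n} realised-k =
    let (m , realised-m , minimal) = least (realisedInP₂? n) realised-k
    in m , (realised-m , λ G pw k ι → minimal (G , pw , ι)) , minimal realised-k

  minIndequeP2-bounds : ∀ n → ∃[ m ] IsMinIndequeP2 n m × n ≤ m + m × m + m ≤ n + 3
  minIndequeP2-bounds n =
    let (G , G-pathwidth , b , G-atMost , b+b≤n+3) = C₄-forest n
        (k , ι@((S , S-indeque , ∣S∣≡k) , _)) = indequeNumber G
        (m , minimum@((_ , pw , ιm) , _) , m≤k) = minIndequeP2-≤ (G , G-pathwidth , ι)
        m≤b = ≤-trans m≤k (subst (_≤ b) ∣S∣≡k (G-atMost S S-indeque))
    in m , minimum , indequeNumber-≥half pw ιm , ≤-trans (+-mono-≤ m≤b m≤b) b+b≤n+3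

open Minimum using (minIndequeP2-bounds)

open import Data.Nat.Coprimality using (Coprime)
open import Data.Integer using (+_; -[1+_]; +<+)
import Data.Integer as ℤ
import Data.Integer.Properties as ℤ
open import Data.Rational using (ℚ; mkℚ; _/_; _-_; ∣_∣; ½; 0ℚ; _<_; *<*; toℚᵘ)
import Data.Rational as ℚ
import Data.Rational.Properties as ℚ
open import Data.Rational.Unnormalised using (mkℚᵘ)
import Data.Rational.Unnormalised as ℚᵘ
import Data.Rational.Unnormalised.Properties as ℚᵘ

-- ∣ m / n - ½ ∣ = (2m - n) / 2n ≤ 3 / 2n, which is below (p + 1) / (q + 1) as soon as n ≥ 3 (q + 1).
½-deviation< : ∀ {m n′ p q} .(c : Coprime (suc p) (suc q)) →
               suc n′ ≤ m + m → m + m ≤ suc n′ + 3 → 3 * suc q ≤ suc n′ →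
               ∣ (+ m / suc n′) - ½ ∣ < mkℚ (+ suc p) q c
½-deviation< {m} {n′} {p} {q} c n≤2m 2m≤n+3 3q≤n = ℚ.toℚᵘ-cancel-< deviation<
  where
  n = suc n′
  d = m * 2 ∸ n

  m*2≡m+m : m * 2 ≡ m + m
  m*2≡m+m = trans (*-comm m 2) (cong (_+_ m) (+-identityʳ m))

  numerator : + m ℤ.* + 2 ℤ.+ -[1+ 0 ] ℤ.* + n ≡ + d
  numerator = begin
    + m ℤ.* + 2 ℤ.+ -[1+ 0 ] ℤ.* + n  ≡⟨ cong₂ ℤ._+_ (sym (ℤ.pos-* m 2)) (ℤ.-1*i≡-i (+ n)) ⟩
    + (m * 2) ℤ.- + n                 ≡⟨ ℤ.m-n≡m⊖n (m * 2) n ⟩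
    (m * 2) ℤ.⊖ n                     ≡⟨ ℤ.⊖-≥ (subst (n ≤_) (sym m*2≡m+m) n≤2m) ⟩
    + d                               ∎
    where open ≡-Reasoning

  d≤3 : d ≤ 3
  d≤3 = ≤-trans (∸-monoˡ-≤ n (subst (_≤ n + 3) (sym m*2≡m+m) 2m≤n+3)) (≤-reflexive (m+n∸m≡n n 3))

  cross : d * suc q ℕ.< suc p * (n * 2)
  cross = begin-strict
    d * suc q        ≤⟨ *-monoˡ-≤ (suc q) d≤3 ⟩
    3 * suc q        ≤⟨ 3q≤n ⟩
    n                <⟨ m<m*n n 2 (s≤s (s≤s z≤n)) ⟩
    n * 2            ≤⟨ m≤n*m (n * 2) (suc p) ⟩
    suc p * (n * 2)  ∎
    where open ≤-Reasoning

  lhs : + (d * suc q) ≡ + ℤ.∣ + m ℤ.* + 2 ℤ.+ -[1+ 0 ] ℤ.* + n ∣ ℤ.* + suc q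
  lhs = trans (ℤ.pos-* d (suc q)) (cong (λ z → + ℤ.∣ z ∣ ℤ.* + suc q) (sym numerator))

  rhs : + (suc p * (n * 2)) ≡ + suc p ℤ.* + (n * 2)
  rhs = ℤ.pos-* (suc p) (n * 2)

  -½≃ : toℚᵘ (ℚ.- ½) ℚᵘ.≃ ℚᵘ.- ℚᵘ.½
  -½≃ = ℚᵘ.≃-trans (ℚ.toℚᵘ-homo‿- ½) (ℚᵘ.-‿cong (ℚ.toℚᵘ-fromℚᵘ ℚᵘ.½))

  deviation< : toℚᵘ ∣ (+ m / n) - ½ ∣ ℚᵘ.< mkℚᵘ (+ suc p) q
  deviation< = begin-strict
    toℚᵘ ∣ (+ m / n) - ½ ∣                   ≃⟨ ℚ.toℚᵘ-homo-∣-∣ _ ⟩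
    ℚᵘ.∣ toℚᵘ ((+ m / n) - ½) ∣              ≃⟨ ℚᵘ.∣-∣-cong (ℚ.toℚᵘ-homo-+ (+ m / n) (ℚ.- ½)) ⟩
    ℚᵘ.∣ toℚᵘ (+ m / n) ℚᵘ.+ toℚᵘ (ℚ.- ½) ∣  ≃⟨ ℚᵘ.∣-∣-cong (ℚᵘ.+-cong (ℚ.toℚᵘ-fromℚᵘ (mkℚᵘ (+ m) n′)) -½≃) ⟩
    ℚᵘ.∣ mkℚᵘ (+ m) n′ ℚᵘ.- ℚᵘ.½ ∣           <⟨ ℚᵘ.*<* (subst₂ ℤ._<_ lhs rhs (+<+ cross)) ⟩
    mkℚᵘ (+ suc p) q                         ∎
    where open ℚᵘ.≤-Reasoning

mainTheorem2 : ∀ (ε : ℚ) → 0ℚ < ε →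
    Σ ℕ λ N → ∀ (n : ℕ) .{{_ : NonZero n}} → Data.Nat._≤_ N n →
      Σ ℕ λ m → IsMinIndequeP2 n m × (∣ ((+ m) / n) - ½ ∣ < ε)
mainTheorem2 (mkℚ (+ suc p) q c) _ = 3 * suc q , λ where
  (suc n′) N≤n →
    let (m , minimum , n≤2m , 2m≤n+3) = minIndequeP2-bounds (suc n′)
    in m , minimum , ½-deviation< {m} c n≤2m 2m≤n+3 N≤n
mainTheorem2 (mkℚ (+ zero)  _ _) (*<* (+<+ ()))
mainTheorem2 (mkℚ -[1+ _ ]  _ _) (*<* ())
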